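{- Let $H$ be a $\{(4,2),(4,3)\}$-free $3$-graph. Then any two distinct maximal cliques of $H$ intersect in at most one vertex.
   Context: A $3$-graph is a pair $H=(V,E)$ with $E\subseteq\binom{V}{3}$. $H$ is $\{(4,2),(4,3)\}$-free if no $4$-vertex subset of $V(H)$ spans exactly $2$ or exactly $3$ edges. A clique is a set of vertices all of whose $3$-subsets are edges; a maximal clique is a clique not properly contained in another clique. -}

module Defs where

open import Data.Nat using (ℕ; zero; suc)
open import Data.Bool using (Bool; true; false; _∧_)
open import Data.List using (List; []; _∷_; map; _++_; length; filter)
open import Data.Vec using (_∷_; [])
open import Data.Fin.Subset using (Subset; _⊆_; _⊂_; ∣_∣; inside; outside)
open import Data.Fin.Subset.Properties using (_⊆?_)
open import Relation.Nullary.Decidable using (⌊_⌋)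
open import Relation.Binary.PropositionalEquality using (_≡_; _≢_)
open import Data.Product using (_×_)

record ThreeGraph (n : ℕ) : Set where
  field
    isEdge    : Subset n → Bool
    edgeSize3 : ∀ (e : Subset n) → isEdge e ≡ true → ∣ e ∣ ≡ 3
open ThreeGraph public

allSubsets : (n : ℕ) → List (Subset n)
allSubsets zero    = [] ∷ []
allSubsets (suc n) = map (outside ∷_) (allSubsets n) ++ map (inside ∷_) (allSubsets n)

edgesIn : ∀ {n} → ThreeGraph n → Subset n → ℕ
edgesIn {n} H S = length (filter (λ T → isEdge H T ≡? true) (filter (λ T → T ⊆? S) (allSubsets n)))
  where
  open import Data.Bool.Properties using () renaming (_≟_ to _≡?_)

Free42-43 : ∀ {n} → ThreeGraph n → Set
Free42-43 {n} H = ∀ (S : Subset n) → ∣ S ∣ ≡ 4 → (edgesIn H S ≢ 2) × (edgesIn H S ≢ 3)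

IsClique : ∀ {n} → ThreeGraph n → Subset n → Set
IsClique {n} H K = ∀ (T : Subset n) → T ⊆ K → ∣ T ∣ ≡ 3 → isEdge H T ≡ true

IsMaximalClique : ∀ {n} → ThreeGraph n → Subset n → Set
IsMaximalClique {n} H K = IsClique H K × (∀ (K' : Subset n) → K ⊂ K' → IsClique H K' → Data.Empty.⊥)
  where import Data.Empty

-- A 4-set of a {(4,2),(4,3)}-free 3-graph spans 0, 1 or 4 edges, so a 4-set
-- containing two edges is a clique. Let the cliques K₁ and K₂ share distinct
-- vertices a and b. A triple of K₁ ∪ K₂ through a and b lies in K₁ or in K₂.
-- A triple T through a but not b lies, with b, in a 4-set containing two
-- triples through a and b, hence is an edge; likewise a triple avoiding a is
-- coned off by a. So K₁ ∪ K₂ is a clique, and maximality gives K₁ = K₁ ∪ K₂ = K₂.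
module Submission where

open import Defs
open import Data.Nat using (ℕ; zero; suc; _+_; _≤_; _<_; z≤n; s≤s; _≤?_; _≟_)
open import Data.Nat.Properties
  using (≤-trans; ≤-reflexive; ≤-pred; +-comm; +-suc; +-monoˡ-≤; +-monoʳ-≤; +-identityʳ; >⇒≢; suc-injective; ≰⇒>; module ≤-Reasoning)
open import Data.Nat.Combinatorics using (_C_; nCk+nC[k+1]≡[n+1]C[k+1])
open import Data.Bool using (true; false)
import Data.Bool.Properties as Bool
open import Data.Fin using (Fin; zero; suc)
open import Data.Fin.Subset
open import Data.Fin.Subset.Properties
open import Data.Vec.Base using ([]; _∷_; here; there)
open import Data.List using (List; []; _∷_; map; _++_; length; filter)
open import Data.List.Properties using (length-++; filter-++; filter-≐; filter-notAll; filter-none)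
open import Data.List.Membership.Propositional using () renaming (_∈_ to _∈ₗ_)
open import Data.List.Membership.Propositional.Properties using (∈-++⁺ˡ; ∈-++⁺ʳ; ∈-map⁺; ∈-filter⁺)
open import Data.List.Relation.Unary.Any as Any using ()
open import Data.List.Relation.Unary.All as All using ()
open import Data.Product using (_×_; _,_; proj₁; proj₂; ∃; ∃₂)
open import Data.Sum using ([_,_]′)
open import Data.Empty using (⊥-elim)
open import Function using (_∘_; id)
open import Level using (Level)
open import Relation.Nullary using (¬_; yes; no; contradiction)
open import Relation.Nullary.Decidable using (_×-dec_; decidable-stable)
open import Relation.Unary using (Pred; Decidable)
open import Relation.Binary.PropositionalEquality using (_≡_; _≢_; refl; sym; trans; cong; cong₂; subst; module ≡-Reasoning)

private
  variable
    ℓ ℓ′ : Level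
    A B : Set ℓ
    n : ℕ

module _ {P : Pred A ℓ} {Q : Pred A ℓ′} (P? : Decidable P) (Q? : Decidable Q) where

  filter-filter : ∀ xs → filter P? (filter Q? xs) ≡ filter (λ x → P? x ×-dec Q? x) xs
  filter-filter []       = refl
  filter-filter (x ∷ xs) with Q? x
  ... | no _ with P? x
  ...   | yes _ = filter-filter xs
  ...   | no  _ = filter-filter xs
  filter-filter (x ∷ xs) | yes _ with P? x
  ...   | yes _ = cong (x ∷_) (filter-filter xs)
  ...   | no  _ = filter-filter xs

  filter-filter-⊆ : P Relation.Unary.⊆ Q → ∀ xs → filter P? (filter Q? xs) ≡ filter P? xs
  filter-filter-⊆ P⊆Q xs =
    trans (filter-filter xs) (filter-≐ (λ x → P? x ×-dec Q? x) P? (proj₁ , λ Px → Px , P⊆Q Px) xs)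

length-filter-map : {P : Pred A ℓ} (P? : Decidable P) (f : B → A) (xs : List B) →
                    length (filter P? (map f xs)) ≡ length (filter (P? ∘ f) xs)
length-filter-map P? f []       = refl
length-filter-map P? f (x ∷ xs) with P? (f x)
... | yes _ = cong suc (length-filter-map P? f xs)
... | no  _ = length-filter-map P? f xs

2≤length : ∀ {x y : A} {xs} → x ∈ₗ xs → y ∈ₗ xs → x ≢ y → 2 ≤ length xs
2≤length {xs = _ ∷ _ ∷ _} _          _          _   = s≤s (s≤s z≤n)
2≤length {xs = _ ∷ []}    (Any.here refl) (Any.here refl) x≢y = contradiction refl x≢y

∈-allSubsets : (p : Subset n) → p ∈ₗ allSubsets n
∈-allSubsets []                    = Any.here refl
∈-allSubsets {suc n} (outside ∷ p) = ∈-++⁺ˡ (∈-map⁺ (outside ∷_) (∈-allSubsets p))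
∈-allSubsets {suc n} (inside  ∷ p) = ∈-++⁺ʳ (map (outside ∷_) (allSubsets n)) (∈-map⁺ (inside ∷_) (∈-allSubsets p))

module _ {P : Pred (Subset (suc n)) ℓ} (P? : Decidable P) where

  length-filter-allSubsets-suc :
    length (filter P? (allSubsets (suc n))) ≡
    length (filter (P? ∘ (outside ∷_)) (allSubsets n)) + length (filter (P? ∘ (inside ∷_)) (allSubsets n))
  length-filter-allSubsets-suc = begin
    length (filter P? (map (outside ∷_) (allSubsets n) ++ map (inside ∷_) (allSubsets n)))
      ≡⟨ cong length (filter-++ P? (map (outside ∷_) (allSubsets n)) _) ⟩
    length (filter P? (map (outside ∷_) (allSubsets n)) ++ filter P? (map (inside ∷_) (allSubsets n)))
      ≡⟨ length-++ (filter P? (map (outside ∷_) (allSubsets n))) ⟩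
    length (filter P? (map (outside ∷_) (allSubsets n))) + length (filter P? (map (inside ∷_) (allSubsets n)))
      ≡⟨ cong₂ _+_ (length-filter-map P? (outside ∷_) (allSubsets n)) (length-filter-map P? (inside ∷_) (allSubsets n)) ⟩
    length (filter (P? ∘ (outside ∷_)) (allSubsets n)) + length (filter (P? ∘ (inside ∷_)) (allSubsets n)) ∎
    where open ≡-Reasoning

length-filter-none : {P : Pred A ℓ} (P? : Decidable P) → (∀ x → ¬ P x) → ∀ xs → length (filter P? xs) ≡ 0
length-filter-none P? ¬P xs = cong length (filter-none P? (All.universal ¬P xs))

family-of-k-subsets≤C : {P : Pred (Subset n) ℓ} (P? : Decidable P) (S : Subset n) (k : ℕ) →
                        (∀ {T} → P T → T ⊆ S × ∣ T ∣ ≡ k) → length (filter P? (allSubsets n)) ≤ ∣ S ∣ C k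
family-of-k-subsets≤C P? [] k sizes with P? []
... | no  _   = z≤n
... | yes P[] with proj₂ (sizes P[])
...   | refl = s≤s z≤n
family-of-k-subsets≤C {suc n} {P = P} P? (s ∷ S) k sizes = begin
  length (filter P? (allSubsets (suc n)))     ≡⟨ length-filter-allSubsets-suc P? ⟩
  #outside + #inside                         ≤⟨ +-monoˡ-≤ #inside (family-of-k-subsets≤C (P? ∘ (outside ∷_)) S k outside-sizes) ⟩
  ∣ S ∣ C k + #inside                        ≤⟨ add-inside s k sizes ⟩
  ∣ s ∷ S ∣ C k                              ∎
  where
  open ≤-Reasoning
  #outside #inside : ℕ
  #outside = length (filter (P? ∘ (outside ∷_)) (allSubsets n))
  #inside  = length (filter (P? ∘ (inside ∷_)) (allSubsets n))

  outside-sizes : ∀ {T} → P (outside ∷ T) → T ⊆ S × ∣ T ∣ ≡ k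
  outside-sizes P[oT] = drop-∷-⊆ (proj₁ (sizes P[oT])) , proj₂ (sizes P[oT])

  no-inside : ∀ {k} → (∀ T → ¬ P (inside ∷ T)) → ∣ S ∣ C k + #inside ≡ ∣ S ∣ C k
  no-inside ¬P = trans (cong (_ +_) (length-filter-none _ ¬P (allSubsets n))) (+-identityʳ _)

  add-inside : ∀ s k → (∀ {T} → P T → T ⊆ s ∷ S × ∣ T ∣ ≡ k) → ∣ S ∣ C k + #inside ≤ ∣ s ∷ S ∣ C k
  add-inside outside k sizes = ≤-reflexive (no-inside {k} (λ T P[iT] → contradiction (proj₁ (sizes P[iT]) here) λ ()))
  add-inside inside zero sizes = ≤-reflexive (no-inside {0} (λ T P[iT] → contradiction (proj₂ (sizes P[iT])) λ ()))
  add-inside inside (suc k) sizes = begin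
    ∣ S ∣ C suc k + #inside     ≤⟨ +-monoʳ-≤ (∣ S ∣ C suc k) (family-of-k-subsets≤C (P? ∘ (inside ∷_)) S k inside-sizes) ⟩
    ∣ S ∣ C suc k + ∣ S ∣ C k   ≡⟨ +-comm (∣ S ∣ C suc k) _ ⟩
    ∣ S ∣ C k + ∣ S ∣ C suc k   ≡⟨ nCk+nC[k+1]≡[n+1]C[k+1] ∣ S ∣ k ⟩
    suc ∣ S ∣ C suc k           ∎
    where
    inside-sizes : ∀ {T} → P (inside ∷ T) → T ⊆ S × ∣ T ∣ ≡ k
    inside-sizes P[iT] = drop-∷-⊆ (proj₁ (sizes P[iT])) , suc-injective (proj₂ (sizes P[iT]))

x∈p⇒⁅x⁆⊆p : ∀ {x : Fin n} {p} → x ∈ p → ⁅ x ⁆ ⊆ p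
x∈p⇒⁅x⁆⊆p {p = p} x∈p y∈⁅x⁆ = subst (_∈ p) (sym (x∈⁅y⁆⇒x≡y _ y∈⁅x⁆)) x∈p

∪-⊆ : ∀ {p q r : Subset n} → p ⊆ r → q ⊆ r → p ∪ q ⊆ r
∪-⊆ {p = p} {q} p⊆r q⊆r x∈p∪q = [ p⊆r , q⊆r ]′ (x∈p∪q⁻ p q x∈p∪q)

x∈p─q⇒x∉q : ∀ {x : Fin n} p q → x ∈ p ─ q → x ∉ q
x∈p─q⇒x∉q (_ ∷ p) (inside ∷ q) ()           here
x∈p─q⇒x∉q (_ ∷ p) (_      ∷ q) (there x∈p─q) (there x∈q) = x∈p─q⇒x∉q p q x∈p─q x∈q

x∈p-y⇒x≢y : ∀ {x y : Fin n} {p} → x ∈ p - y → x ≢ y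
x∈p-y⇒x≢y {p = p} x∈p-y refl = x∈p─q⇒x∉q p _ x∈p-y (x∈⁅x⁆ _)

p⊈q⇒∃∈p∉q : ∀ {p q : Subset n} → p ⊈ q → ∃ λ x → x ∈ p × x ∉ q
p⊈q⇒∃∈p∉q {p = p} {q} p⊈q with nonempty? (p ─ q)
... | yes (x , x∈p─q) = x , p─q⊆p p q x∈p─q , x∈p─q⇒x∉q p q x∈p─q
... | no  p─q-empty   = ⊥-elim (p⊈q p⊆q)
  where
  p⊆q : p ⊆ q
  p⊆q {x} x∈p = decidable-stable (x ∈? q) (λ x∉q → p─q-empty (x , x∈p∧x∉q⇒x∈p─q x∈p x∉q))

∣q∣+∣p─q∣≡∣p∣ : ∀ {p q : Subset n} → q ⊆ p → ∣ q ∣ + ∣ p ─ q ∣ ≡ ∣ p ∣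
∣q∣+∣p─q∣≡∣p∣ {p = []}          {[]}          _   = refl
∣q∣+∣p─q∣≡∣p∣ {p = outside ∷ p} {outside ∷ q} q⊆p = ∣q∣+∣p─q∣≡∣p∣ (drop-∷-⊆ q⊆p)
∣q∣+∣p─q∣≡∣p∣ {p = outside ∷ p} {inside  ∷ q} q⊆p = contradiction (q⊆p here) λ ()
∣q∣+∣p─q∣≡∣p∣ {p = inside  ∷ p} {outside ∷ q} q⊆p = trans (+-suc ∣ q ∣ _) (cong suc (∣q∣+∣p─q∣≡∣p∣ (drop-∷-⊆ q⊆p)))
∣q∣+∣p─q∣≡∣p∣ {p = inside  ∷ p} {inside  ∷ q} q⊆p = cong suc (∣q∣+∣p─q∣≡∣p∣ (drop-∷-⊆ q⊆p))

∣q∣≤1⇒2≤∣p─q∣ : ∀ {p q : Subset n} → q ⊆ p → ∣ p ∣ ≡ 3 → ∣ q ∣ ≤ 1 → 2 ≤ ∣ p ─ q ∣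
∣q∣≤1⇒2≤∣p─q∣ {p = p} {q} q⊆p ∣p∣≡3 ∣q∣≤1 = ≤-pred (begin
  3                   ≡⟨ sym ∣p∣≡3 ⟩
  ∣ p ∣               ≡⟨ sym (∣q∣+∣p─q∣≡∣p∣ q⊆p) ⟩
  ∣ q ∣ + ∣ p ─ q ∣   ≤⟨ +-monoˡ-≤ ∣ p ─ q ∣ ∣q∣≤1 ⟩
  suc ∣ p ─ q ∣       ∎)
  where open ≤-Reasoning

x∈p⇒suc∣p-x∣≡∣p∣ : ∀ {x : Fin n} {p} → x ∈ p → suc ∣ p - x ∣ ≡ ∣ p ∣
x∈p⇒suc∣p-x∣≡∣p∣ {x = x} {p} x∈p =
  trans (cong (_+ ∣ p - x ∣) (sym (∣⁅x⁆∣≡1 x))) (∣q∣+∣p─q∣≡∣p∣ (x∈p⇒⁅x⁆⊆p x∈p))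

x∉p⇒∣⁅x⁆∪p∣≡suc∣p∣ : ∀ {x : Fin n} {p} → x ∉ p → ∣ ⁅ x ⁆ ∪ p ∣ ≡ suc ∣ p ∣
x∉p⇒∣⁅x⁆∪p∣≡suc∣p∣ {x = zero}  {outside ∷ p} _   = cong (suc ∘ ∣_∣) (∪-identityˡ p)
x∉p⇒∣⁅x⁆∪p∣≡suc∣p∣ {x = zero}  {inside  ∷ p} x∉p = contradiction here x∉p
x∉p⇒∣⁅x⁆∪p∣≡suc∣p∣ {x = suc x} {outside ∷ p} x∉p = x∉p⇒∣⁅x⁆∪p∣≡suc∣p∣ (x∉p ∘ there)
x∉p⇒∣⁅x⁆∪p∣≡suc∣p∣ {x = suc x} {inside  ∷ p} x∉p = cong suc (x∉p⇒∣⁅x⁆∪p∣≡suc∣p∣ (x∉p ∘ there))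

0<∣p∣⇒Nonempty : ∀ {p : Subset n} → 0 < ∣ p ∣ → Nonempty p
0<∣p∣⇒Nonempty {n} {p} 0<∣p∣ with nonempty? p
... | yes p≢∅ = p≢∅
... | no  p≡∅ = contradiction (trans (cong ∣_∣ (Empty-unique p≡∅)) (∣⊥∣≡0 n)) (>⇒≢ 0<∣p∣)

2≤∣p∣⇒∃distinct : ∀ {p : Subset n} → 2 ≤ ∣ p ∣ → ∃₂ λ x y → x ∈ p × y ∈ p × x ≢ y
2≤∣p∣⇒∃distinct {p = p} 2≤∣p∣ with 0<∣p∣⇒Nonempty (≤-trans (s≤s z≤n) 2≤∣p∣)
... | x , x∈p with 0<∣p∣⇒Nonempty {p = p - x} (≤-pred (≤-trans 2≤∣p∣ (≤-reflexive (sym (x∈p⇒suc∣p-x∣≡∣p∣ x∈p)))))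
...   | y , y∈p-x = x , y , x∈p , p─q⊆p p ⁅ x ⁆ y∈p-x , λ x≡y → x∈p-y⇒x≢y y∈p-x (sym x≡y)

∣p∣≤1⇒x≡y : ∀ {p : Subset n} {x y} → ∣ p ∣ ≤ 1 → x ∈ p → y ∈ p → x ≡ y
∣p∣≤1⇒x≡y {p = p} {x} {y} ∣p∣≤1 x∈p y∈p with x Data.Fin.≟ y
... | yes x≡y = x≡y
... | no  x≢y = contradiction (≤-trans (s≤s (0<∣p-x∣)) (≤-trans (≤-reflexive (x∈p⇒suc∣p-x∣≡∣p∣ x∈p)) ∣p∣≤1)) λ { (s≤s ()) }
  where
  0<∣p-x∣ : 0 < ∣ p - x ∣
  0<∣p-x∣ = ≤-trans (s≤s z≤n) (≤-reflexive (x∈p⇒suc∣p-x∣≡∣p∣ (x∈p∧x≢y⇒x∈p-y y∈p (x≢y ∘ sym))))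

module _ (H : ThreeGraph n) where

  Edge : Subset n → Set
  Edge T = isEdge H T ≡ true

  edge? : Decidable Edge
  edge? T = isEdge H T Bool.≟ true

  edgesIn≡length-filter : ∀ S → edgesIn H S ≡ length (filter (λ T → edge? T ×-dec T ⊆? S) (allSubsets n))
  edgesIn≡length-filter S = cong length (filter-filter edge? (_⊆? S) (allSubsets n))

  2≤edgesIn : ∀ {S A B} → A ⊆ S → B ⊆ S → A ≢ B → Edge A → Edge B → 2 ≤ edgesIn H S
  2≤edgesIn {S} A⊆S B⊆S A≢B eA eB rewrite edgesIn≡length-filter S =
    2≤length (listed eA A⊆S) (listed eB B⊆S) A≢B
    where
    listed : ∀ {T} → Edge T → T ⊆ S → T ∈ₗ filter (λ T → edge? T ×-dec T ⊆? S) (allSubsets n)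
    listed {T} eT T⊆S = ∈-filter⁺ (λ T → edge? T ×-dec T ⊆? S) (∈-allSubsets T) (eT , T⊆S)

  -- The 3-subsets of S number ∣ S ∣ C 3, and X is one of them that is not an edge.
  edgesIn<4 : ∀ {S X} → ∣ S ∣ ≡ 4 → X ⊆ S → ∣ X ∣ ≡ 3 → ¬ Edge X → edgesIn H S < 4
  edgesIn<4 {S} {X} ∣S∣≡4 X⊆S ∣X∣≡3 ¬eX = begin-strict
    edgesIn H S                              ≡⟨ edgesIn≡length-filter S ⟩
    length (filter edgeIn? (allSubsets n))   ≡⟨ cong length (filter-filter-⊆ edgeIn? triple? edge⇒triple (allSubsets n)) ⟨
    length (filter edgeIn? triples)          <⟨ filter-notAll edgeIn? triples X-missing ⟩
    length triples                           ≤⟨ family-of-k-subsets≤C triple? S 3 (λ triple → triple) ⟩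
    ∣ S ∣ C 3                                ≡⟨ cong (_C 3) ∣S∣≡4 ⟩
    4                                        ∎
    where
    open ≤-Reasoning
    edgeIn? : Decidable (λ T → Edge T × T ⊆ S)
    edgeIn? T = edge? T ×-dec T ⊆? S
    triple? : Decidable (λ T → T ⊆ S × ∣ T ∣ ≡ 3)
    triple? T = T ⊆? S ×-dec ∣ T ∣ ≟ 3
    triples : List (Subset n)
    triples = filter triple? (allSubsets n)
    edge⇒triple : ∀ {T} → Edge T × T ⊆ S → T ⊆ S × ∣ T ∣ ≡ 3
    edge⇒triple {T} (eT , T⊆S) = T⊆S , edgeSize3 H T eT
    X-missing : Any.Any (λ T → ¬ (Edge T × T ⊆ S)) triples
    X-missing = Any.map (λ { refl (eX , _) → ¬eX eX }) (∈-filter⁺ triple? (∈-allSubsets X) (X⊆S , ∣X∣≡3))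

  isClique-of-two-edges : Free42-43 H → ∀ {S A B} → ∣ S ∣ ≡ 4 → A ⊆ S → B ⊆ S → A ≢ B →
                          Edge A → Edge B → IsClique H S
  isClique-of-two-edges free {S} ∣S∣≡4 A⊆S B⊆S A≢B eA eB T T⊆S ∣T∣≡3 with isEdge H T in eT
  ... | true  = refl
  ... | false = ⊥-elim (excluded (2≤edgesIn A⊆S B⊆S A≢B eA eB) (edgesIn<4 ∣S∣≡4 T⊆S ∣T∣≡3 ¬eT) (free S ∣S∣≡4))
    where
    ¬eT : ¬ Edge T
    ¬eT e with () ← trans (sym eT) e
    excluded : ∀ {m} → 2 ≤ m → m < 4 → ¬ (m ≢ 2 × m ≢ 3)
    excluded {1} (s≤s ()) _ _
    excluded {2} _ _ (≢2 , _) = contradiction refl ≢2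
    excluded {3} _ _ (_ , ≢3) = contradiction refl ≢3
    excluded {suc (suc (suc (suc _)))} _ (s≤s (s≤s (s≤s (s≤s ())))) _

  EdgesThrough : Subset n → Subset n → Set
  EdgesThrough U D = ∀ T → T ⊆ U → D ⊆ T → ∣ T ∣ ≡ 3 → Edge T

  edge-of-cone : Free42-43 H → ∀ {c T x y} → c ∉ T → ∣ T ∣ ≡ 3 → x ∈ T → y ∈ T → x ≢ y →
                 Edge (⁅ c ⁆ ∪ T - x) → Edge (⁅ c ⁆ ∪ T - y) → Edge T
  edge-of-cone free {c} {T} {x} {y} c∉T ∣T∣≡3 x∈T y∈T x≢y e₋x e₋y =
    isClique-of-two-edges free ∣S∣≡4 (p─q⊆p S _) (p─q⊆p S _) faces-differ e₋x e₋y T (q⊆p∪q ⁅ c ⁆ T) ∣T∣≡3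
    where
    S : Subset n
    S = ⁅ c ⁆ ∪ T
    ∣S∣≡4 : ∣ S ∣ ≡ 4
    ∣S∣≡4 = trans (x∉p⇒∣⁅x⁆∪p∣≡suc∣p∣ c∉T) (cong suc ∣T∣≡3)
    faces-differ : S - x ≢ S - y
    faces-differ S-x≡S-y = x∈p-y⇒x≢y (subst (x ∈_) (sym S-x≡S-y) (x∈p∧x≢y⇒x∈p-y (q⊆p∪q ⁅ c ⁆ T x∈T) x≢y)) refl

  edgesThrough-drop : Free42-43 H → ∀ {U D c} → c ∈ U → ∣ D ∣ ≤ 1 →
                      EdgesThrough U (⁅ c ⁆ ∪ D) → EdgesThrough U D
  edgesThrough-drop free {U} {D} {c} c∈U ∣D∣≤1 through T T⊆U D⊆T ∣T∣≡3 with c ∈? T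
  ... | yes c∈T = through T T⊆U (∪-⊆ (x∈p⇒⁅x⁆⊆p c∈T) D⊆T) ∣T∣≡3
  ... | no  c∉T with 2≤∣p∣⇒∃distinct (∣q∣≤1⇒2≤∣p─q∣ D⊆T ∣T∣≡3 ∣D∣≤1)
  ...   | x , y , x∈T─D , y∈T─D , x≢y =
    edge-of-cone free c∉T ∣T∣≡3 (p─q⊆p T D x∈T─D) (p─q⊆p T D y∈T─D) x≢y (face x∈T─D) (face y∈T─D)
    where
    face : ∀ {z} → z ∈ T ─ D → Edge (⁅ c ⁆ ∪ T - z)
    face {z} z∈T─D = through (⁅ c ⁆ ∪ T - z) face⊆U through-face ∣face∣≡3
      where
      z∈T : z ∈ T
      z∈T = p─q⊆p T D z∈T─D
      face⊆U : ⁅ c ⁆ ∪ T - z ⊆ U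
      face⊆U = ⊆-trans (p─q⊆p _ _) (∪-⊆ (x∈p⇒⁅x⁆⊆p c∈U) T⊆U)
      c≢z : c ≢ z
      c≢z refl = c∉T z∈T
      D∌z : ∀ {w} → w ∈ D → w ≢ z
      D∌z w∈D refl = x∈p─q⇒x∉q T D z∈T─D w∈D
      through-face : ⁅ c ⁆ ∪ D ⊆ ⁅ c ⁆ ∪ T - z
      through-face = ∪-⊆ (x∈p⇒⁅x⁆⊆p (x∈p∧x≢y⇒x∈p-y (p⊆p∪q T (x∈⁅x⁆ c)) c≢z))
                         (λ w∈D → x∈p∧x≢y⇒x∈p-y (q⊆p∪q ⁅ c ⁆ T (D⊆T w∈D)) (D∌z w∈D))
      ∣face∣≡3 : ∣ ⁅ c ⁆ ∪ T - z ∣ ≡ 3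
      ∣face∣≡3 = suc-injective (begin
        suc ∣ ⁅ c ⁆ ∪ T - z ∣   ≡⟨ x∈p⇒suc∣p-x∣≡∣p∣ (q⊆p∪q ⁅ c ⁆ T z∈T) ⟩
        ∣ ⁅ c ⁆ ∪ T ∣           ≡⟨ x∉p⇒∣⁅x⁆∪p∣≡suc∣p∣ c∉T ⟩
        suc ∣ T ∣               ≡⟨ cong suc ∣T∣≡3 ⟩
        4                       ∎)
        where open ≡-Reasoning

  -- A triple through D that is not inside K₁ has a vertex x ∉ K₁; its third vertex, outside D, must be x.
  edgesThrough-∪ : ∀ {K₁ K₂ D} → IsClique H K₁ → IsClique H K₂ → D ⊆ K₁ ∩ K₂ → ∣ D ∣ ≡ 2 →
                   EdgesThrough (K₁ ∪ K₂) D
  edgesThrough-∪ {K₁} {K₂} {D} clique₁ clique₂ D⊆K₁∩K₂ ∣D∣≡2 T T⊆K₁∪K₂ D⊆T ∣T∣≡3 with T ⊆? K₁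
  ... | yes T⊆K₁ = clique₁ T T⊆K₁ ∣T∣≡3
  ... | no  T⊈K₁ with p⊈q⇒∃∈p∉q T⊈K₁
  ...   | x , x∈T , x∉K₁ = clique₂ T T⊆K₂ ∣T∣≡3
    where
    ∣T─D∣≤1 : ∣ T ─ D ∣ ≤ 1
    ∣T─D∣≤1 = ≤-reflexive (suc-injective (suc-injective
                (trans (cong (_+ ∣ T ─ D ∣) (sym ∣D∣≡2)) (trans (∣q∣+∣p─q∣≡∣p∣ D⊆T) ∣T∣≡3))))
    x∈K₂ : x ∈ K₂
    x∈K₂ = [ (λ x∈K₁ → contradiction x∈K₁ x∉K₁) , id ]′ (x∈p∪q⁻ K₁ K₂ (T⊆K₁∪K₂ x∈T))
    x∈T─D : x ∈ T ─ D
    x∈T─D = x∈p∧x∉q⇒x∈p─q x∈T (λ x∈D → x∉K₁ (p∩q⊆p K₁ K₂ (D⊆K₁∩K₂ x∈D)))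
    T⊆K₂ : T ⊆ K₂
    T⊆K₂ {w} w∈T with w ∈? D
    ... | yes w∈D = p∩q⊆q K₁ K₂ (D⊆K₁∩K₂ w∈D)
    ... | no  w∉D = subst (_∈ K₂) (∣p∣≤1⇒x≡y ∣T─D∣≤1 x∈T─D (x∈p∧x∉q⇒x∈p─q w∈T w∉D)) x∈K₂

  ∪-isClique : Free42-43 H → ∀ {K₁ K₂ a b} → IsClique H K₁ → IsClique H K₂ →
               a ∈ K₁ ∩ K₂ → b ∈ K₁ ∩ K₂ → a ≢ b → IsClique H (K₁ ∪ K₂)
  ∪-isClique free {K₁} {K₂} {a} {b} clique₁ clique₂ a∈K₁∩K₂ b∈K₁∩K₂ a≢b T T⊆K₁∪K₂ ∣T∣≡3 =
    through-∅ T T⊆K₁∪K₂ ⊥⊆ ∣T∣≡3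
    where
    ∈K₁∪K₂ : ∀ {x} → x ∈ K₁ ∩ K₂ → x ∈ K₁ ∪ K₂
    ∈K₁∪K₂ x∈K₁∩K₂ = p⊆p∪q K₂ (p∩q⊆p K₁ K₂ x∈K₁∩K₂)
    through-ab : EdgesThrough (K₁ ∪ K₂) (⁅ a ⁆ ∪ ⁅ b ⁆)
    through-ab = edgesThrough-∪ clique₁ clique₂ (∪-⊆ (x∈p⇒⁅x⁆⊆p a∈K₁∩K₂) (x∈p⇒⁅x⁆⊆p b∈K₁∩K₂))
                   (trans (x∉p⇒∣⁅x⁆∪p∣≡suc∣p∣ (x≢y⇒x∉⁅y⁆ a≢b)) (cong suc (∣⁅x⁆∣≡1 b)))
    through-b : EdgesThrough (K₁ ∪ K₂) ⁅ b ⁆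
    through-b = edgesThrough-drop free (∈K₁∪K₂ a∈K₁∩K₂) (≤-reflexive (∣⁅x⁆∣≡1 b)) through-ab
    through-∅ : EdgesThrough (K₁ ∪ K₂) ⊥
    through-∅ = edgesThrough-drop free (∈K₁∪K₂ b∈K₁∩K₂) (≤-trans (≤-reflexive (∣⊥∣≡0 n)) z≤n)
                  (subst (EdgesThrough (K₁ ∪ K₂)) (sym (∪-identityʳ ⁅ b ⁆)) through-b)

maximal-⊆-isClique⇒≡ : ∀ (H : ThreeGraph n) {K K′} → IsMaximalClique H K → K ⊆ K′ → IsClique H K′ → K ≡ K′
maximal-⊆-isClique⇒≡ H {K} {K′} (_ , maximal) K⊆K′ clique′ with K′ ⊆? K
... | yes K′⊆K = ⊆-antisym K⊆K′ K′⊆K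
... | no  K′⊈K = ⊥-elim (maximal K′ (K⊆K′ , p⊈q⇒∃∈p∉q K′⊈K) clique′)

lemma5p2 : ∀ {n : ℕ} (H : ThreeGraph n) → Free42-43 H →
    ∀ (K₁ K₂ : Subset n) → IsMaximalClique H K₁ → IsMaximalClique H K₂ →
    K₁ ≢ K₂ → ∣ K₁ ∩ K₂ ∣ ≤ 1
lemma5p2 H free K₁ K₂ maximal₁ maximal₂ K₁≢K₂ with ∣ K₁ ∩ K₂ ∣ ≤? 1
... | yes ∣K₁∩K₂∣≤1 = ∣K₁∩K₂∣≤1
... | no  ∣K₁∩K₂∣≰1 with 2≤∣p∣⇒∃distinct (≰⇒> ∣K₁∩K₂∣≰1)
...   | a , b , a∈K₁∩K₂ , b∈K₁∩K₂ , a≢b = contradiction (trans K₁≡K₁∪K₂ (sym K₂≡K₁∪K₂)) K₁≢K₂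
  where
  K₁∪K₂-clique : IsClique H (K₁ ∪ K₂)
  K₁∪K₂-clique = ∪-isClique H free (proj₁ maximal₁) (proj₁ maximal₂) a∈K₁∩K₂ b∈K₁∩K₂ a≢b
  K₁≡K₁∪K₂ : K₁ ≡ K₁ ∪ K₂
  K₁≡K₁∪K₂ = maximal-⊆-isClique⇒≡ H maximal₁ (p⊆p∪q K₂) K₁∪K₂-clique
  K₂≡K₁∪K₂ : K₂ ≡ K₁ ∪ K₂
  K₂≡K₁∪K₂ = maximal-⊆-isClique⇒≡ H maximal₂ (q⊆p∪q K₁ K₂) K₁∪K₂-clique
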